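{- Let $\sigma$ be a weakly consecutive permutation of $[k]$, and let $q$ be a prime such that $q+2$ is also prime and $\lceil k/2\rceil<q\le k$. Suppose $\sigma(q-2)=q$ and $\sigma(q)=q+2$. Then the permutation $G_q(\sigma)$ of $[k]$ defined by $G_q(\sigma)(q-2)=q+2$, $G_q(\sigma)(q)=q$, and $G_q(\sigma)(i)=\sigma(i)$ for all other $i$, is weakly consecutive.
   Context: $[k]=\{1,\dots,k\}$. A permutation $\sigma:[k]\to[k]$ is weakly consecutive if for all $i,j\in[k]$ and all integers $m$, whenever $m\mid\sigma(i)$ and $m\mid(i-j)$, also $m\mid\sigma(j)$. -}

module Defs where

open import Data.Nat using (ℕ; _≤_; _∸_; _+_; _≟_)
open import Data.Integer using (ℤ; +_; _-_)
open import Data.Integer.Divisibility using (_∣_)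
open import Data.Product using (_×_; Σ)
open import Relation.Binary.PropositionalEquality using (_≡_)
open import Relation.Nullary using (yes; no)

InRange : ℕ → ℕ → Set
InRange k i = 1 ≤ i × i ≤ k

-- σ : ℕ → ℕ restricts to a permutation of [k] (values outside [k] irrelevant)
IsPerm : ℕ → (ℕ → ℕ) → Set
IsPerm k σ =
  (∀ i → InRange k i → InRange k (σ i)) ×
  (∀ i j → InRange k i → InRange k j → σ i ≡ σ j → i ≡ j) ×
  (∀ j → InRange k j → Σ ℕ (λ i → InRange k i × σ i ≡ j))

WeaklyConsecutive : ℕ → (ℕ → ℕ) → Set
WeaklyConsecutive k σ =
  ∀ i j → InRange k i → InRange k j → (m : ℤ) →
  m ∣ (+ σ i) → m ∣ (+ i - + j) → m ∣ (+ σ j)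

G : ℕ → (ℕ → ℕ) → ℕ → ℕ
G q σ i with i ≟ q ∸ 2
... | yes _ = q + 2
... | no _ with i ≟ q
...   | yes _ = q
...   | no _ = σ i

-- G q σ is σ composed with the transposition of q − 2 and q, hence a
-- permutation. Let m ∣ G(i) and m ∣ i − j. If i ∈ {q − 2, q}, then G(i) is the
-- prime q + 2 resp. q, and as k < 2q the gap |i − j| is smaller than it, so
-- m = ±1 or i = j. Otherwise G(i) = σ(i) and σ gives m ∣ σ(j); if moreover
-- j ∈ {q − 2, q}, then σ(j) is a prime p, and m = ±p would force σ(i) = p,
-- since p is the only multiple of p below 2p, so i = j by injectivity.
module Submission where

open import Defs
open import Data.Nat using (ℕ; _≤_; _<_; _+_; _∸_; ⌈_/2⌉)
open import Data.Nat.Primality using (Prime)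
open import Data.Product using (_×_)
open import Relation.Binary.PropositionalEquality using (_≡_)

open import Data.Nat using (zero; suc; z≤n; s≤s; _*_; ⌊_/2⌋; _≟_; ∣_-_∣)
open import Data.Nat.Properties
open import Data.Nat.Divisibility using (_∣_; divides; 1∣_; >⇒∤)
open import Data.Nat.Primality
  using (prime⇒irreducible; ¬prime[0]; ¬prime[1]; composite⇒¬prime; composite[4])
open import Data.Integer as ℤ using (+_; _⊖_)
open import Data.Integer.Properties using (m-n≡m⊖n; ∣⊖∣-≤; ∣m⊖n∣≡∣n⊖m∣)
open import Data.Product using (_,_; proj₁; proj₂)
open import Data.Sum using (_⊎_; inj₁; inj₂; [_,_]′)
open import Function using (_∘_)
open import Relation.Nullary using (yes; no; contradiction)
open import Relation.Binary.PropositionalEquality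
  using (_≢_; refl; sym; trans; cong; subst; _≗_; module ≡-Reasoning)

∣+m-+n∣≡∣m-n∣ : ∀ m n → ℤ.∣ + m ℤ.- + n ∣ ≡ ∣ m - n ∣
∣+m-+n∣≡∣m-n∣ m n with ≤-total m n
... | inj₁ m≤n = begin
  ℤ.∣ + m ℤ.- + n ∣ ≡⟨ cong ℤ.∣_∣ (m-n≡m⊖n m n) ⟩
  ℤ.∣ m ⊖ n ∣       ≡⟨ ∣⊖∣-≤ m≤n ⟩
  n ∸ m             ≡⟨ m≤n⇒∣m-n∣≡n∸m m≤n ⟨
  ∣ m - n ∣         ∎
  where open ≡-Reasoning
... | inj₂ n≤m = begin
  ℤ.∣ + m ℤ.- + n ∣ ≡⟨ cong ℤ.∣_∣ (m-n≡m⊖n m n) ⟩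
  ℤ.∣ m ⊖ n ∣       ≡⟨ ∣m⊖n∣≡∣n⊖m∣ m n ⟩
  ℤ.∣ n ⊖ m ∣       ≡⟨ ∣⊖∣-≤ n≤m ⟩
  m ∸ n             ≡⟨ m≤n⇒∣m-n∣≡n∸m n≤m ⟨
  ∣ n - m ∣         ≡⟨ ∣-∣-comm n m ⟩
  ∣ m - n ∣         ∎
  where open ≡-Reasoning

∣m-n∣<o : ∀ {m n o} → m < n + o → n < m + o → ∣ m - n ∣ < o
∣m-n∣<o {m} {n} {zero} m<n+0 n<m+0 =
  contradiction (subst (n <_) (+-identityʳ m) n<m+0) (<-asym (subst (m <_) (+-identityʳ n) m<n+0))
∣m-n∣<o {m} {n} {suc _} m<n+o n<m+o with ∣m-n∣≡[m∸n]∨[n∸m] m n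
... | inj₁ eq = subst (_< _) (sym eq) (m<n+o⇒m∸n<o m n m<n+o)
... | inj₂ eq = subst (_< _) (sym eq) (m<n+o⇒m∸n<o n m n<m+o)

⌈n/2⌉<m⇒n<m+m : ∀ {n m} → ⌈ n /2⌉ < m → n < m + m
⌈n/2⌉<m⇒n<m+m {n} {m} ⌈n/2⌉<m = begin-strict
  n                   ≡⟨ ⌊n/2⌋+⌈n/2⌉≡n n ⟨
  ⌊ n /2⌋ + ⌈ n /2⌉   ≤⟨ +-monoˡ-≤ ⌈ n /2⌉ (⌊n/2⌋≤⌈n/2⌉ n) ⟩
  ⌈ n /2⌉ + ⌈ n /2⌉   <⟨ +-mono-< ⌈n/2⌉<m ⌈n/2⌉<m ⟩
  m + m               ∎
  where open ≤-Reasoning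

∣∧<⇒≡0 : ∀ {d n} → d ∣ n → n < d → n ≡ 0
∣∧<⇒≡0 {n = zero}  _   _   = refl
∣∧<⇒≡0 {n = suc _} d∣n n<d = contradiction d∣n (>⇒∤ n<d)

∣∧<2*⇒≡ : ∀ {d n} → d ∣ n → 0 < n → n < d + d → n ≡ d
∣∧<2*⇒≡ {d} (divides (suc zero)    refl) _ _ = +-identityʳ d
∣∧<2*⇒≡ {d} (divides (suc (suc c)) refl) _ n<d+d =
  contradiction (+-monoʳ-≤ d (m≤m+n d (c * d))) (<⇒≱ n<d+d)

≡1⇒∣ : ∀ {d n} → d ≡ 1 → d ∣ n
≡1⇒∣ {n = n} refl = 1∣ n

twin-primes⇒2<p : ∀ {p} → Prime p → Prime (p + 2) → 2 < p
twin-primes⇒2<p {0}       p-prime _         = contradiction p-prime ¬prime[0]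
twin-primes⇒2<p {1}       p-prime _         = contradiction p-prime ¬prime[1]
twin-primes⇒2<p {2}       _       4-prime   = contradiction 4-prime (composite⇒¬prime composite[4])
twin-primes⇒2<p {suc (suc (suc _))} _ _     = s≤s (s≤s (s≤s z≤n))

∣prime∧∣∣i-j∣⇒≡1⊎≡ : ∀ {p d i j} → Prime p → ∣ i - j ∣ < p →
                      d ∣ p → d ∣ ∣ i - j ∣ → d ≡ 1 ⊎ i ≡ j
∣prime∧∣∣i-j∣⇒≡1⊎≡ p-prime gap<p d∣p d∣gap with prime⇒irreducible p-prime d∣p
... | inj₁ d≡1 = inj₁ d≡1
... | inj₂ refl = inj₂ (∣m-n∣≡0⇒m≡n (∣∧<⇒≡0 d∣gap gap<p))

∣prime-value⇒≡1⊎≡ : ∀ {k σ p d i j} → IsPerm k σ → InRange k i → InRange k j →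
                     k < p + p → Prime p → σ j ≡ p → d ∣ p → d ∣ σ i → d ≡ 1 ⊎ i ≡ j
∣prime-value⇒≡1⊎≡ (range , injective , _) i∈k j∈k k<p+p p-prime σj≡p d∣p d∣σi
  with prime⇒irreducible p-prime d∣p
... | inj₁ d≡1 = inj₁ d≡1
... | inj₂ refl = inj₂ (injective _ _ i∈k j∈k (trans σi≡p (sym σj≡p)))
  where
  σi≡p = ∣∧<2*⇒≡ d∣σi (proj₁ (range _ i∈k)) (≤-<-trans (proj₂ (range _ i∈k)) k<p+p)

IsPerm-resp-≗ : ∀ {k f g} → f ≗ g → IsPerm k f → IsPerm k g
IsPerm-resp-≗ {k} f≗g (range , injective , surjective) =
    (λ i i∈k → subst (InRange k) (f≗g i) (range i i∈k))
  , (λ i j i∈k j∈k gi≡gj → injective i j i∈k j∈k (trans (f≗g i) (trans gi≡gj (sym (f≗g j)))))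
  , λ j j∈k → let (i , i∈k , fi≡j) = surjective j j∈k in i , i∈k , trans (sym (f≗g i)) fi≡j

IsPerm-∘ : ∀ {k σ π} → IsPerm k σ → IsPerm k π → IsPerm k (σ ∘ π)
IsPerm-∘ {σ = σ} (σ-range , σ-injective , σ-surjective) (π-range , π-injective , π-surjective) =
    (λ i i∈k → σ-range _ (π-range i i∈k))
  , (λ i j i∈k j∈k eq →
       π-injective i j i∈k j∈k (σ-injective _ _ (π-range i i∈k) (π-range j j∈k) eq))
  , λ j j∈k → let (i , i∈k , σi≡j) = σ-surjective j j∈k
                  (h , h∈k , πh≡i) = π-surjective i i∈k
              in h , h∈k , trans (cong σ πh≡i) σi≡j

involution⇒IsPerm : ∀ {k f} → (∀ i → InRange k i → InRange k (f i)) →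
                    (∀ i → f (f i) ≡ i) → IsPerm k f
involution⇒IsPerm {f = f} range involutive =
    range
  , (λ i j _ _ fi≡fj → trans (sym (involutive i)) (trans (cong f fi≡fj) (involutive j)))
  , λ j j∈k → f j , range j j∈k , involutive j

swap : ℕ → ℕ → ℕ → ℕ
swap a b i with i ≟ a
... | yes _ = b
... | no _ with i ≟ b
...   | yes _ = a
...   | no _ = i

swap-range : ∀ {k a b} → InRange k a → InRange k b → ∀ i → InRange k i → InRange k (swap a b i)
swap-range {a = a} {b} a∈k b∈k i i∈k with i ≟ a
... | yes _ = b∈k
... | no _ with i ≟ b
...   | yes _ = a∈k
...   | no _ = i∈k

swap-at-first : ∀ a b → swap a b a ≡ b
swap-at-first a b with a ≟ a
... | yes _ = refl
... | no a≢a = contradiction refl a≢a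

swap-at-second : ∀ a b → swap a b b ≡ a
swap-at-second a b with b ≟ a
... | yes b≡a = b≡a
... | no _ with b ≟ b
...   | yes _ = refl
...   | no b≢b = contradiction refl b≢b

swap-involutive : ∀ a b i → swap a b (swap a b i) ≡ i
swap-involutive a b i with i ≟ a
... | yes refl = swap-at-second i b
... | no i≢a with i ≟ b
...   | yes refl = swap-at-first a i
...   | no i≢b with i ≟ a
...     | yes i≡a = contradiction i≡a i≢a
...     | no _ with i ≟ b
...       | yes i≡b = contradiction i≡b i≢b
...       | no _ = refl

G≗σ∘swap : ∀ {q σ} → σ (q ∸ 2) ≡ q → σ q ≡ q + 2 → G q σ ≗ σ ∘ swap (q ∸ 2) q
G≗σ∘swap {q} σ[q∸2]≡q σq≡q+2 i with i ≟ q ∸ 2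
... | yes refl = sym σq≡q+2
... | no _ with i ≟ q
...   | yes refl = sym σ[q∸2]≡q
...   | no _ = refl

G-at-q∸2 : ∀ q σ → G q σ (q ∸ 2) ≡ q + 2
G-at-q∸2 q σ with q ∸ 2 ≟ q ∸ 2
... | yes _ = refl
... | no ≢ = contradiction refl ≢

G-at-q : ∀ {q} σ → 0 < q → G q σ q ≡ q
G-at-q {q} σ 0<q with q ≟ q ∸ 2
... | yes q≡q∸2 = contradiction q≡q∸2 (q≢q∸2 0<q)
  where
  q≢q∸2 : ∀ {q} → 0 < q → q ≢ q ∸ 2
  q≢q∸2 {suc _} _ = 1+m≢m∸n 1
... | no _ with q ≟ q
...   | yes _ = refl
...   | no q≢q = contradiction refl q≢q

G-isPerm : ∀ {k q σ} → IsPerm k σ → 2 < q → q ≤ k →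
           σ (q ∸ 2) ≡ q → σ q ≡ q + 2 → IsPerm k (G q σ)
G-isPerm {k} {q} σ-perm 2<q q≤k σ[q∸2]≡q σq≡q+2 =
  IsPerm-resp-≗ (sym ∘ G≗σ∘swap σ[q∸2]≡q σq≡q+2)
    (IsPerm-∘ σ-perm (involution⇒IsPerm (swap-range q∸2∈k q∈k) (swap-involutive (q ∸ 2) q)))
  where
  q∸2∈k : InRange k (q ∸ 2)
  q∸2∈k = m<n⇒0<n∸m 2<q , ≤-trans (m∸n≤m q 2) q≤k
  q∈k : InRange k q
  q∈k = ≤-trans (s≤s z≤n) 2<q , q≤k

≡1⊎≡⇒∣ : ∀ {f : ℕ → ℕ} {d i j} → d ≡ 1 ⊎ i ≡ j → d ∣ f i → d ∣ f j
≡1⊎≡⇒∣ (inj₁ d≡1) _   = ≡1⇒∣ d≡1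
≡1⊎≡⇒∣ (inj₂ refl) d∣fi = d∣fi

module _ {k q σ} (σ-perm : IsPerm k σ) (σ-wc : WeaklyConsecutive k σ)
         (q-prime : Prime q) (q+2-prime : Prime (q + 2)) (2<q : 2 < q) (k<q+q : k < q + q)
         (σ[q∸2]≡q : σ (q ∸ 2) ≡ q) (σq≡q+2 : σ q ≡ q + 2) where

  private
    j<q+q : ∀ {j} → InRange k j → j < q + q
    j<q+q j∈k = ≤-<-trans (proj₂ j∈k) k<q+q

    q∸2+[q+2]≡q+q : q ∸ 2 + (q + 2) ≡ q + q
    q∸2+[q+2]≡q+q = begin
      q ∸ 2 + (q + 2)   ≡⟨ cong (λ n → q ∸ 2 + n) (+-comm q 2) ⟩
      q ∸ 2 + (2 + q)   ≡⟨ +-assoc (q ∸ 2) 2 q ⟨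
      q ∸ 2 + 2 + q     ≡⟨ cong (_+ q) (m∸n+n≡m (<⇒≤ 2<q)) ⟩
      q + q             ∎
      where open ≡-Reasoning

    ∣q∸2-j∣<q+2 : ∀ {j} → InRange k j → ∣ q ∸ 2 - j ∣ < q + 2
    ∣q∸2-j∣<q+2 {j} j∈k = ∣m-n∣<o
      (≤-<-trans (m∸n≤m q 2) (<-≤-trans (m<m+n q (s≤s z≤n)) (m≤n+m (q + 2) j)))
      (subst (j <_) (sym q∸2+[q+2]≡q+q) (j<q+q j∈k))

    ∣q-j∣<q : ∀ {j} → InRange k j → ∣ q - j ∣ < q
    ∣q-j∣<q j∈k = ∣m-n∣<o (+-monoˡ-≤ q (proj₁ j∈k)) (j<q+q j∈k)

    k<[q+2]+[q+2] : k < q + 2 + (q + 2)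
    k<[q+2]+[q+2] = <-≤-trans k<q+q (+-mono-≤ (m≤m+n q 2) (m≤m+n q 2))

  G-weaklyConsecutive : WeaklyConsecutive k (G q σ)
  G-weaklyConsecutive i j i∈k j∈k m m∣Gi m∣i-j with i ≟ q ∸ 2
  ... | yes refl =
    ≡1⊎≡⇒∣ {G q σ} {i = q ∸ 2} {j} (∣prime∧∣∣i-j∣⇒≡1⊎≡ q+2-prime (∣q∸2-j∣<q+2 j∈k) m∣Gi
                     (subst (ℤ.∣ m ∣ ∣_) (∣+m-+n∣≡∣m-n∣ _ j) m∣i-j))
                   (subst (ℤ.∣ m ∣ ∣_) (sym (G-at-q∸2 q σ)) m∣Gi)
  ... | no i≢q∸2 with i ≟ q
  ...   | yes refl =
    ≡1⊎≡⇒∣ {G q σ} {i = q} {j} (∣prime∧∣∣i-j∣⇒≡1⊎≡ q-prime (∣q-j∣<q j∈k) m∣Gi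
                     (subst (ℤ.∣ m ∣ ∣_) (∣+m-+n∣≡∣m-n∣ _ j) m∣i-j))
                   (subst (ℤ.∣ m ∣ ∣_) (sym (G-at-q σ (<-trans (s≤s z≤n) 2<q))) m∣Gi)
  ...   | no i≢q with j ≟ q ∸ 2
  ...     | yes refl =
    [ ≡1⇒∣ , (λ i≡q∸2 → contradiction i≡q∸2 i≢q∸2) ]′
      (∣prime-value⇒≡1⊎≡ σ-perm i∈k j∈k k<q+q q-prime σ[q∸2]≡q
        (subst (ℤ.∣ m ∣ ∣_) σ[q∸2]≡q (σ-wc i j i∈k j∈k m m∣Gi m∣i-j)) m∣Gi)
  ...     | no _ with j ≟ q
  ...       | yes refl =
    [ ≡1⇒∣ , (λ i≡q → contradiction i≡q i≢q) ]′
      (∣prime-value⇒≡1⊎≡ σ-perm i∈k j∈k k<[q+2]+[q+2] q+2-prime σq≡q+2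
        (subst (ℤ.∣ m ∣ ∣_) σq≡q+2 (σ-wc i j i∈k j∈k m m∣Gi m∣i-j)) m∣Gi)
  ...       | no _ = σ-wc i j i∈k j∈k m m∣Gi m∣i-j

mainTheorem10 : (k q : ℕ) (σ : ℕ → ℕ) →
    IsPerm k σ → WeaklyConsecutive k σ →
    Prime q → Prime (q + 2) → ⌈ k /2⌉ < q → q ≤ k →
    σ (q ∸ 2) ≡ q → σ q ≡ q + 2 →
    IsPerm k (G q σ) × WeaklyConsecutive k (G q σ)
mainTheorem10 k q σ σ-perm σ-wc q-prime q+2-prime ⌈k/2⌉<q q≤k σ[q∸2]≡q σq≡q+2 =
    G-isPerm σ-perm 2<q q≤k σ[q∸2]≡q σq≡q+2
  , G-weaklyConsecutive σ-perm σ-wc q-prime q+2-prime 2<q (⌈n/2⌉<m⇒n<m+m ⌈k/2⌉<q)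
      σ[q∸2]≡q σq≡q+2
  where
  2<q : 2 < q
  2<q = twin-primes⇒2<p q-prime q+2-prime
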